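{- Let $\mu=(m,1,1,\dots,1)$ be a hook shape and let $\alpha=(\alpha_1,\dots,\alpha_M)$ be a content with $\alpha_M>0$ and $\sum\alpha_i=|\mu|$. Then there is a bijection $\phi:\mathcal{F}_\mu^\alpha\to\mathcal{F}_{\mu^\ast}^{r(\alpha)}$ such that $\operatorname{maj}(\phi(\sigma))=\operatorname{inv}(\sigma)$ and $\operatorname{inv}(\phi(\sigma))=\operatorname{maj}(\sigma)$ for every $\sigma\in\mathcal{F}_\mu^\alpha$. In particular, for every $a,b$ it restricts to a bijection from the fillings in $\mathcal{F}_\mu^\alpha$ with $\operatorname{inv}=a,\operatorname{maj}=b$ to the fillings in $\mathcal{F}_{\mu^\ast}^{r(\alpha)}$ with $\operatorname{inv}=b,\operatorname{maj}=a$.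
   Context: Young diagrams are in French notation (row 1 at the bottom). A filling of $\mu$ assigns a positive integer to each cell; it has content $\alpha$ if exactly $\alpha_i$ cells contain $i$; $\mathcal{F}_\mu^\alpha$ is the set of such fillings. $\mu^\ast$ is the conjugate partition, and $r(\alpha)=(\alpha_M,\alpha_{M-1},\dots,\alpha_1)$ is the reverse of $\alpha$. $\operatorname{maj}(\sigma)$: for each column read top to bottom as $w_1\cdots w_m$, sum the indices $k$ with $w_k>w_{k+1}$; sum over columns. $\operatorname{inv}(\sigma)$: the number of attacking pairs (pairs of entries $u>v$ with $u,v$ in the same row and $u$ left of $v$, or $u$ in the row immediately above $v$ and strictly to its right) minus the sum, over descent cells (cells whose entry is strictly greater than the entry directly below), of the number of cells strictly to the right of that cell in its row. -}

module Defs where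

open import Data.Nat using (ℕ; zero; suc; _+_; _∸_; _≤_; _<ᵇ_; _≡ᵇ_; _≤?_; _≟_)
open import Data.Bool using (Bool; true; false; if_then_else_; _∧_; _∨_)
open import Data.Maybe using (Maybe; just; nothing)
open import Data.Product using (_×_; _,_)
open import Data.Nat.ListAction using (sum)
open import Data.List using (List; []; _∷_; map; length; concat; zipWith; upTo; filter;
  cartesianProduct; reverse; mapMaybe; replicate)
open import Data.List.Relation.Unary.All using (All)
open import Data.Integer using (ℤ; +_; _-_)
open import Relation.Binary.PropositionalEquality using (_≡_)

-- A filling is a list of rows, row 1 (the bottom row, French notation) first;
-- each row lists its entries from left to right. Indices below are 0-based.
Filling : Set
Filling = List (List ℕ)

nth : {A : Set} → List A → ℕ → Maybe A
nth []       _       = nothing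
nth (x ∷ xs) zero    = just x
nth (x ∷ xs) (suc n) = nth xs n

nthOr0 : List ℕ → ℕ → ℕ
nthOr0 xs i with nth xs i
... | just x  = x
... | nothing = 0

headOr0 : List ℕ → ℕ
headOr0 []      = 0
headOr0 (x ∷ _) = x

entry : Filling → ℕ → ℕ → Maybe ℕ
entry σ r c with nth σ r
... | just row = nth row c
... | nothing  = nothing

count : ℕ → Filling → ℕ
count i σ = sum (map (λ row → length (filter (i ≟_) row)) σ)

-- σ is a filling of shape μ (list of row lengths, bottom row first) with content α
-- (α_i = number of cells containing i, with α_i = 0 beyond the length of α)
IsFilling : List ℕ → List ℕ → Filling → Set
IsFilling μ α σ =
  (map length σ ≡ μ) × All (All (1 ≤_)) σ × (∀ i → count (suc i) σ ≡ nthOr0 α i)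

-- hook shape (m, 1, ..., 1) with m = suc a and k rows of length 1 on top
hook : ℕ → ℕ → List ℕ
hook a k = suc a ∷ replicate k 1

conj : List ℕ → List ℕ
conj μ = map (λ j → length (filter (suc j ≤?_) μ)) (upTo (headOr0 μ))

majWordFrom : ℕ → List ℕ → ℕ
majWordFrom k []           = 0
majWordFrom k (x ∷ [])     = 0
majWordFrom k (x ∷ y ∷ ws) = (if y <ᵇ x then k else 0) + majWordFrom (suc k) (y ∷ ws)

majWord : List ℕ → ℕ
majWord = majWordFrom 1

columnTopDown : Filling → ℕ → List ℕ
columnTopDown σ c = reverse (mapMaybe (λ row → nth row c) σ)

maj : Filling → ℕ
maj σ = sum (map (λ c → majWord (columnTopDown σ c)) (upTo (headOr0 (map length σ))))

Cell : Set
Cell = ℕ × ℕ × ℕ   -- (row, column, entry), 0-based row/column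

cellsRow : ℕ → List ℕ → List Cell
cellsRow r row = zipWith (λ c v → (r , c , v)) (upTo (length row)) row

cells : Filling → List Cell
cells σ = concat (zipWith cellsRow (upTo (length σ)) σ)

attackingInv : Cell → Cell → Bool
attackingInv (ru , cu , u) (rv , cv , v) =
  (v <ᵇ u) ∧ (((ru ≡ᵇ rv) ∧ (cu <ᵇ cv)) ∨ ((ru ≡ᵇ suc rv) ∧ (cv <ᵇ cu)))

attackingCount : Filling → ℕ
attackingCount σ =
  sum (map (λ p → if attackingInv (Data.Product.proj₁ p) (Data.Product.proj₂ p) then 1 else 0)
           (cartesianProduct (cells σ) (cells σ)))

isDescent : Filling → Cell → Bool
isDescent σ (zero , c , v)  = false
isDescent σ (suc r , c , v) with entry σ r c
... | just b  = b <ᵇ v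
... | nothing = false

rowLength : Filling → ℕ → ℕ
rowLength σ r with nth σ r
... | just row = length row
... | nothing  = 0

armLength : Filling → Cell → ℕ
armLength σ (r , c , v) = rowLength σ r ∸ suc c

descentArms : Filling → ℕ
descentArms σ = sum (map (λ x → if isDescent σ x then armLength σ x else 0) (cells σ))

inv : Filling → ℤ
inv σ = + attackingCount σ - + descentArms σ

-- A filling of a hook is determined by its bottom row r and its first column c,
-- which share the corner entry. The cells above the corner attack nothing and
-- have no arm, so inv is the inversion number of r, while maj is the major index
-- of c read downwards. Foata's bijection Φ fixes the last letter and carries maj
-- to inv, and both reversal and the complement x ↦ M + 1 − x on {1, …, M}
-- exchange inversions with non-inversions. Hence the map sending (r, c) to the
-- hook with bottom row the reversed complement of Φ(c) and column (read
-- downwards) Φ⁻¹ of the reversed complement of r exchanges inv and maj, lands in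
-- the conjugate hook with the reversed content, and is an involution.

module Submission where

open import Defs
open import Data.Bool using (Bool; true; false; if_then_else_; not; T)
open import Data.Bool.Properties using (T-≡; ∧-zeroʳ; ∧-identityʳ)
open import Data.Nat
  using (ℕ; zero; suc; _+_; _∸_; _≤_; _<_; _<ᵇ_; _≡ᵇ_; z≤n; s≤s; z<s; s<s; _≤?_; _≟_)
open import Data.Nat.Properties
open import Data.Nat.ListAction using (sum)
open import Data.Nat.ListAction.Properties using (sum-++)
open import Data.List
  using (List; []; _∷_; _++_; _∷ʳ_; [_]; length; map; reverse; filter; replicate; applyUpTo;
         concat; mapMaybe; cartesianProduct; zipWith; drop)
open import Data.List.Properties
  using (++-assoc; unfold-reverse; length-reverse; reverse-involutive; ∷-injectiveˡ; ∷-injectiveʳ;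
         map-applyUpTo; concat-map-[_]; map-++; map-∘; length-map)
open import Data.List.Relation.Unary.All using (All; []; _∷_; head) renaming (map to mapAll)
import Data.List.Relation.Unary.All.Properties as All
open import Data.List.Relation.Binary.Permutation.Propositional
  using (_↭_; module PermutationReasoning; ↭-refl; ↭-prep; ↭-swap; ↭-trans; ↭-sym; ↭-reflexive)
import Data.List.Relation.Binary.Permutation.Propositional as Perm
open import Data.List.Relation.Binary.Permutation.Propositional.Properties
  using (↭-length; All-resp-↭; drop-∷)
  renaming (map⁺ to ↭-map⁺; ++⁺ to ↭-++⁺; ++-comm to ↭-++-comm)
open import Data.Maybe using (just; nothing; maybe′; fromMaybe)
open import Data.Product using (Σ; ∃; ∃₂; _×_; _,_; proj₁; proj₂)
open import Data.Integer using (+_)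
open import Function using (_∘_)
open import Function.Bundles using (Equivalence)
open import Relation.Nullary using (contradiction; yes; no)
open import Data.Empty using (⊥-elim)
open import Data.Sum using (inj₁; inj₂)
open import Relation.Binary.Core using (_Preserves_⟶_)
open import Relation.Binary.PropositionalEquality hiding ([_])
open import Data.Nat.Tactic.RingSolver using (solve-∀)

<⇒<ᵇ≡true : ∀ {m n} → m < n → (m <ᵇ n) ≡ true
<⇒<ᵇ≡true m<n = Equivalence.to T-≡ (<⇒<ᵇ m<n)

<ᵇ≡true⇒< : ∀ m n → (m <ᵇ n) ≡ true → m < n
<ᵇ≡true⇒< m n eq = <ᵇ⇒< m n (Equivalence.from T-≡ eq)

≤⇒>ᵇ≡false : ∀ {m n} → n ≤ m → (m <ᵇ n) ≡ false
≤⇒>ᵇ≡false {m} {n} n≤m with m <ᵇ n in eq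
... | false = refl
... | true  = contradiction (<ᵇ≡true⇒< m n eq) (≤⇒≯ n≤m)

<ᵇ≡false⇒≥ : ∀ m n → (m <ᵇ n) ≡ false → n ≤ m
<ᵇ≡false⇒≥ m n eq = ≮⇒≥ (λ m<n → subst T eq (<⇒<ᵇ m<n))

≡ᵇ-≡-true : ∀ {m n} → (m ≡ᵇ n) ≡ true → m ≡ n
≡ᵇ-≡-true {m} {n} eq = ≡ᵇ⇒≡ m n (Equivalence.from T-≡ eq)

≡ᵇ-cong : ∀ {m n m′ n′} → (m ≡ n → m′ ≡ n′) → (m′ ≡ n′ → m ≡ n) → (m ≡ᵇ n) ≡ (m′ ≡ᵇ n′)
≡ᵇ-cong {m} {n} {m′} {n′} to from with m ≡ᵇ n in e | m′ ≡ᵇ n′ in e′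
... | true  | true  = refl
... | false | false = refl
... | true  | false = ⊥-elim (subst T e′ (≡⇒≡ᵇ m′ n′ (to (≡ᵇ-≡-true e))))
... | false | true  = ⊥-elim (subst T e (≡⇒≡ᵇ m n (from (≡ᵇ-≡-true e′))))

≢⇒≡ᵇ≡false : ∀ {m n} → m ≢ n → (m ≡ᵇ n) ≡ false
≢⇒≡ᵇ≡false {m} {n} m≢n with m ≡ᵇ n in e
... | false = refl
... | true  = ⊥-elim (m≢n (≡ᵇ-≡-true e))

countᵇ : (ℕ → Bool) → List ℕ → ℕ
countᵇ q []      = 0
countᵇ q (x ∷ l) = if q x then suc (countᵇ q l) else countᵇ q l

countᵇ-accept : ∀ q x l → q x ≡ true → countᵇ q (x ∷ l) ≡ suc (countᵇ q l)
countᵇ-accept q x l qx rewrite qx = refl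

countᵇ-reject : ∀ q x l → q x ≡ false → countᵇ q (x ∷ l) ≡ countᵇ q l
countᵇ-reject q x l qx rewrite qx = refl

countᵇ-++ : ∀ q l m → countᵇ q (l ++ m) ≡ countᵇ q l + countᵇ q m
countᵇ-++ q []      m = refl
countᵇ-++ q (x ∷ l) m with q x
... | true  = cong suc (countᵇ-++ q l m)
... | false = countᵇ-++ q l m

countᵇ-↭ : ∀ q {l m} → l ↭ m → countᵇ q l ≡ countᵇ q m
countᵇ-↭ q Perm.refl = refl
countᵇ-↭ q (Perm.prep x p) with q x
... | true  = cong suc (countᵇ-↭ q p)
... | false = countᵇ-↭ q p
countᵇ-↭ q (Perm.swap x y p) with q x | q y
... | true  | true  = cong (suc ∘ suc) (countᵇ-↭ q p)
... | true  | false = cong suc (countᵇ-↭ q p)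
... | false | true  = cong suc (countᵇ-↭ q p)
... | false | false = countᵇ-↭ q p
countᵇ-↭ q (Perm.trans p p′) = trans (countᵇ-↭ q p) (countᵇ-↭ q p′)

countᵇ-map : ∀ q (f : ℕ → ℕ) l → countᵇ q (map f l) ≡ countᵇ (q ∘ f) l
countᵇ-map q f []      = refl
countᵇ-map q f (x ∷ l) with q (f x)
... | true  = cong suc (countᵇ-map q f l)
... | false = countᵇ-map q f l

countᵇ-cong : ∀ {R : ℕ → Set} q q′ {l} → All R l → (∀ {x} → R x → q x ≡ q′ x) →
              countᵇ q l ≡ countᵇ q′ l
countᵇ-cong q q′ []             eq = refl
countᵇ-cong q q′ {x ∷ _} (r ∷ rs) eq with q x | q′ x | eq r
... | true  | .true  | refl = cong suc (countᵇ-cong q q′ rs eq)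
... | false | .false | refl = countᵇ-cong q q′ rs eq

countᵇ-false : ∀ l → countᵇ (λ _ → false) l ≡ 0
countᵇ-false []      = refl
countᵇ-false (x ∷ l) = countᵇ-false l

countᵇ-not-+ : ∀ q l → countᵇ (not ∘ q) l + countᵇ q l ≡ length l
countᵇ-not-+ q []      = refl
countᵇ-not-+ q (x ∷ l) with q x
... | true  = trans (+-suc _ _) (cong suc (countᵇ-not-+ q l))
... | false = cong suc (countᵇ-not-+ q l)

countᵇ-∷-≡0 : ∀ q x l → countᵇ q (x ∷ l) ≡ 0 → countᵇ q l ≡ 0
countᵇ-∷-≡0 q x l eq with q x
... | false = eq

sum-map-++ : {A : Set} (f : A → ℕ) (l m : List A) → sum (map f (l ++ m)) ≡ sum (map f l) + sum (map f m)
sum-map-++ f l m = trans (cong sum (map-++ f l m)) (sum-++ (map f l) (map f m))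

sum-map-+ : {A : Set} (f g : A → ℕ) (l : List A) →
            sum (map (λ x → f x + g x) l) ≡ sum (map f l) + sum (map g l)
sum-map-+ f g []      = refl
sum-map-+ f g (x ∷ l) rewrite sum-map-+ f g l = interchange (f x) (g x) _ _
  where
  interchange : ∀ a b c d → a + b + (c + d) ≡ a + c + (b + d)
  interchange = solve-∀

sum-map-cong : {A : Set} {P : A → Set} (f g : A → ℕ) {l : List A} → All P l →
               (∀ {x} → P x → f x ≡ g x) → sum (map f l) ≡ sum (map g l)
sum-map-cong f g []       _  = refl
sum-map-cong f g (p ∷ ps) eq = cong₂ _+_ (eq p) (sum-map-cong f g ps eq)

sum-map-≡0 : {A : Set} {P : A → Set} (f : A → ℕ) {l : List A} → All P l →
             (∀ {x} → P x → f x ≡ 0) → sum (map f l) ≡ 0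
sum-map-≡0 f []       _   = refl
sum-map-≡0 f (p ∷ ps) f≡0 rewrite f≡0 p = sum-map-≡0 f ps f≡0

sum-map-cartesianProduct : {A B : Set} (g : A × B → ℕ) (X : List A) (Y : List B) →
  sum (map g (cartesianProduct X Y)) ≡ sum (map (λ x → sum (map (λ y → g (x , y)) Y)) X)
sum-map-cartesianProduct g []      Y = refl
sum-map-cartesianProduct g (x ∷ X) Y = begin
    sum (map g (map (x ,_) Y ++ cartesianProduct X Y))
  ≡⟨ sum-map-++ g (map (x ,_) Y) (cartesianProduct X Y) ⟩
    sum (map g (map (x ,_) Y)) + sum (map g (cartesianProduct X Y))
  ≡⟨ cong₂ _+_ (cong sum (sym (map-∘ Y))) (sum-map-cartesianProduct g X Y) ⟩
    sum (map (λ y → g (x , y)) Y) + sum (map (λ x → sum (map (λ y → g (x , y)) Y)) X) ∎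
  where open ≡-Reasoning

sum-applyUpTo-≡0 : ∀ (f : ℕ → ℕ) n → (∀ i → f i ≡ 0) → sum (applyUpTo f n) ≡ 0
sum-applyUpTo-≡0 f zero    _  = refl
sum-applyUpTo-≡0 f (suc n) f≡0 rewrite f≡0 0 = sum-applyUpTo-≡0 (f ∘ suc) n (f≡0 ∘ suc)

applyUpTo-replicate : ∀ (f : ℕ → ℕ) c n → (∀ i → i < n → f i ≡ c) → applyUpTo f n ≡ replicate n c
applyUpTo-replicate f c zero    _  = refl
applyUpTo-replicate f c (suc n) eq =
  cong₂ _∷_ (eq 0 z<s) (applyUpTo-replicate (f ∘ suc) c n (λ i i<n → eq (suc i) (s<s i<n)))

nthOr0≡ : ∀ l i → nthOr0 l i ≡ fromMaybe 0 (nth l i)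
nthOr0≡ l i with nth l i
... | just _  = refl
... | nothing = refl

nth-beyond : ∀ (l : List ℕ) i → length l ≤ i → nth l i ≡ nothing
nth-beyond []      i       _       = refl
nth-beyond (x ∷ l) (suc i) (s≤s p) = nth-beyond l i p

nth-∷ʳ-< : ∀ (l : List ℕ) x i → i < length l → nth (l ∷ʳ x) i ≡ nth l i
nth-∷ʳ-< (y ∷ l) x zero    _       = refl
nth-∷ʳ-< (y ∷ l) x (suc i) (s≤s p) = nth-∷ʳ-< l x i p

nth-∷ʳ-length : ∀ (l : List ℕ) x → nth (l ∷ʳ x) (length l) ≡ just x
nth-∷ʳ-length []      x = refl
nth-∷ʳ-length (y ∷ l) x = nth-∷ʳ-length l x

nth-reverse : ∀ (l : List ℕ) i → i < length l → nth (reverse l) i ≡ nth l (length l ∸ suc i)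
nth-reverse (x ∷ l) i i<1+l with m<1+n⇒m<n∨m≡n i<1+l
... | inj₁ i<l = begin
    nth (reverse (x ∷ l)) i
  ≡⟨ cong (λ w → nth w i) (unfold-reverse x l) ⟩
    nth (reverse l ∷ʳ x) i
  ≡⟨ nth-∷ʳ-< (reverse l) x i (subst (i <_) (sym (length-reverse l)) i<l) ⟩
    nth (reverse l) i
  ≡⟨ nth-reverse l i i<l ⟩
    nth l (length l ∸ suc i)
  ≡⟨ cong (nth (x ∷ l)) (sym (+-∸-assoc 1 i<l)) ⟩
    nth (x ∷ l) (suc (length l) ∸ suc i) ∎
  where open ≡-Reasoning
... | inj₂ refl = begin
    nth (reverse (x ∷ l)) (length l)
  ≡⟨ cong (λ w → nth w (length l)) (unfold-reverse x l) ⟩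
    nth (reverse l ∷ʳ x) (length l)
  ≡⟨ cong (nth (reverse l ∷ʳ x)) (sym (length-reverse l)) ⟩
    nth (reverse l ∷ʳ x) (length (reverse l))
  ≡⟨ nth-∷ʳ-length (reverse l) x ⟩
    just x
  ≡⟨ cong (nth (x ∷ l)) (sym (n∸n≡0 (length l))) ⟩
    nth (x ∷ l) (length l ∸ length l) ∎
  where open ≡-Reasoning

inversions : List ℕ → ℕ
inversions []      = 0
inversions (x ∷ l) = countᵇ (_<ᵇ x) l + inversions l

coinversions : List ℕ → ℕ
coinversions []      = 0
coinversions (x ∷ l) = countᵇ (x <ᵇ_) l + coinversions l

revMaj : List ℕ → ℕ
revMaj []          = 0
revMaj (x ∷ [])    = 0
revMaj (x ∷ y ∷ l) = (if x <ᵇ y then suc (length l) else 0) + revMaj (y ∷ l)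

private
  prependDescent : ∀ {A B} k n b d → A ≡ B + (if b then suc k + n else 0) →
    (if d then k else 0) + A ≡ ((if d then k else 0) + B) + (if b then k + suc n else 0)
  prependDescent {B = B} k n b d eq rewrite eq | +-suc k n = sym (+-assoc (if d then k else 0) B _)

majWordFrom-∷ʳ : ∀ k w y x → majWordFrom k ((w ∷ʳ y) ∷ʳ x) ≡
                 majWordFrom k (w ∷ʳ y) + (if x <ᵇ y then k + length w else 0)
majWordFrom-∷ʳ k []           y x with x <ᵇ y
... | true  = refl
... | false = refl
majWordFrom-∷ʳ k (z ∷ [])     y x =
  prependDescent k 0 (x <ᵇ y) (y <ᵇ z) (majWordFrom-∷ʳ (suc k) [] y x)
majWordFrom-∷ʳ k (z ∷ z′ ∷ w) y x =
  prependDescent k (length (z′ ∷ w)) (x <ᵇ y) (z′ <ᵇ z) (majWordFrom-∷ʳ (suc k) (z′ ∷ w) y x)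

majWord-reverse : ∀ l → majWord (reverse l) ≡ revMaj l
majWord-reverse []          = refl
majWord-reverse (x ∷ [])    = refl
majWord-reverse (x ∷ y ∷ l) = begin
    majWord (reverse (x ∷ y ∷ l))
  ≡⟨ cong majWord (trans (unfold-reverse x (y ∷ l)) (cong (_∷ʳ x) (unfold-reverse y l))) ⟩
    majWord ((reverse l ∷ʳ y) ∷ʳ x)
  ≡⟨ majWordFrom-∷ʳ 1 (reverse l) y x ⟩
    majWord (reverse l ∷ʳ y) + (if x <ᵇ y then suc (length (reverse l)) else 0)
  ≡⟨ cong₂ _+_ (trans (cong majWord (sym (unfold-reverse y l))) (majWord-reverse (y ∷ l)))
               (cong (λ n → if x <ᵇ y then suc n else 0) (length-reverse l)) ⟩
    revMaj (y ∷ l) + (if x <ᵇ y then suc (length l) else 0)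
  ≡⟨ +-comm (revMaj (y ∷ l)) _ ⟩
    revMaj (x ∷ y ∷ l) ∎
  where open ≡-Reasoning

-- Foata's bijection

-- Words are stored last letter first throughout: reverse ∘ foata ∘ reverse is
-- Foata's map, and coinversions (resp. revMaj) of a stored word are the
-- inversions (resp. major index) of the word it stores.

side : ℕ → Bool → ℕ → Bool
side a true  x = a <ᵇ x
side a false x = not (a <ᵇ x)

side-self : ∀ a x → side a (a <ᵇ x) x ≡ true
side-self a x with a <ᵇ x in eq
... | true  = eq
... | false = cong not eq

side-true⇒ : ∀ a d x → side a d x ≡ true → (a <ᵇ x) ≡ d
side-true⇒ a true  x eq = eq
side-true⇒ a false x eq with a <ᵇ x
... | false = refl
side-true⇒ a false x () | true

-- Foata's rotation of the blocks cut out by the letters satisfying p: the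
-- carried letter moves right up to the next such letter, which is carried on.
carry : (ℕ → Bool) → ℕ → List ℕ → List ℕ
carry p y []      = y ∷ []
carry p y (x ∷ l) = if p x then y ∷ carry p x l else x ∷ carry p y l

rotate : (ℕ → Bool) → List ℕ → List ℕ
rotate p []      = []
rotate p (y ∷ l) = carry p y l

foataStep : ℕ → List ℕ → List ℕ
foataStep a u = rotate (side a (a <ᵇ headOr0 u)) u

foata : List ℕ → List ℕ
foata []      = []
foata (a ∷ l) = a ∷ foataStep a (foata l)

carry-↭ : ∀ p y l → carry p y l ↭ y ∷ l
carry-↭ p y []      = ↭-refl
carry-↭ p y (x ∷ l) with p x
... | true  = ↭-prep y (carry-↭ p x l)
... | false = ↭-trans (↭-prep x (carry-↭ p y l)) (↭-swap x y ↭-refl)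

foataStep-↭ : ∀ a u → foataStep a u ↭ u
foataStep-↭ a []      = ↭-refl
foataStep-↭ a (y ∷ l) = carry-↭ _ y l

foata-↭ : ∀ l → foata l ↭ l
foata-↭ []      = ↭-refl
foata-↭ (a ∷ l) = ↭-prep a (↭-trans (foataStep-↭ a (foata l)) (foata-↭ l))

-- Carrying y across the letters on the other side of a changes the number of
-- coinversions by exactly the number of those letters; this is Foata's key step.
coinversions-carry-small : ∀ a y l → (a <ᵇ y) ≡ false →
  coinversions (carry (side a false) y l) + countᵇ (a <ᵇ_) l ≡ coinversions (y ∷ l)
coinversions-carry-small a y []      _   = refl
coinversions-carry-small a y (x ∷ l) a<ᵇy with a <ᵇ x in a<ᵇx
... | false = begin
    (countᵇ (y <ᵇ_) (carry p x l) + coinversions (carry p x l)) + countᵇ (a <ᵇ_) l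
  ≡⟨ +-assoc (countᵇ (y <ᵇ_) (carry p x l)) _ _ ⟩
    countᵇ (y <ᵇ_) (carry p x l) + (coinversions (carry p x l) + countᵇ (a <ᵇ_) l)
  ≡⟨ cong₂ _+_ (countᵇ-↭ (y <ᵇ_) (carry-↭ p x l)) (coinversions-carry-small a x l a<ᵇx) ⟩
    countᵇ (y <ᵇ_) (x ∷ l) + coinversions (x ∷ l) ∎
  where
  open ≡-Reasoning
  p = side a false
... | true = begin
    (countᵇ (x <ᵇ_) (carry p y l) + coinversions (carry p y l)) + suc (countᵇ (a <ᵇ_) l)
  ≡⟨ cong (λ n → (n + coinversions (carry p y l)) + suc (countᵇ (a <ᵇ_) l))
       (trans (countᵇ-↭ (x <ᵇ_) (carry-↭ p y l)) (countᵇ-reject (x <ᵇ_) y l (≤⇒>ᵇ≡false (<⇒≤ y<x)))) ⟩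
    (X + coinversions (carry p y l)) + suc (countᵇ (a <ᵇ_) l)
  ≡⟨ rearrange X _ _ ⟩
    suc X + (coinversions (carry p y l) + countᵇ (a <ᵇ_) l)
  ≡⟨ cong (_+_ (suc X)) (coinversions-carry-small a y l a<ᵇy) ⟩
    suc X + (countᵇ (y <ᵇ_) l + coinversions l)
  ≡⟨ rearrange′ X (countᵇ (y <ᵇ_) l) _ ⟩
    suc (countᵇ (y <ᵇ_) l) + (X + coinversions l)
  ≡⟨ cong (_+ (X + coinversions l)) (sym (countᵇ-accept (y <ᵇ_) x l (<⇒<ᵇ≡true y<x))) ⟩
    countᵇ (y <ᵇ_) (x ∷ l) + (X + coinversions l) ∎
  where
  open ≡-Reasoning
  p = side a false
  X = countᵇ (x <ᵇ_) l
  y<x : y < x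
  y<x = ≤-<-trans (<ᵇ≡false⇒≥ a y a<ᵇy) (<ᵇ≡true⇒< a x a<ᵇx)
  rearrange : ∀ m n k → (m + n) + suc k ≡ suc m + (n + k)
  rearrange = solve-∀
  rearrange′ : ∀ m n k → suc m + (n + k) ≡ suc n + (m + k)
  rearrange′ = solve-∀

coinversions-carry-large : ∀ a y l → (a <ᵇ y) ≡ true →
  coinversions (carry (a <ᵇ_) y l) ≡ coinversions (y ∷ l) + countᵇ (not ∘ (a <ᵇ_)) l
coinversions-carry-large a y []      _   = refl
coinversions-carry-large a y (x ∷ l) a<ᵇy with a <ᵇ x in a<ᵇx
... | true = begin
    countᵇ (y <ᵇ_) (carry (a <ᵇ_) x l) + coinversions (carry (a <ᵇ_) x l)
  ≡⟨ cong₂ _+_ (countᵇ-↭ (y <ᵇ_) (carry-↭ (a <ᵇ_) x l)) (coinversions-carry-large a x l a<ᵇx) ⟩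
    countᵇ (y <ᵇ_) (x ∷ l) + (coinversions (x ∷ l) + countᵇ (not ∘ (a <ᵇ_)) l)
  ≡⟨ +-assoc (countᵇ (y <ᵇ_) (x ∷ l)) _ _ ⟨
    (countᵇ (y <ᵇ_) (x ∷ l) + coinversions (x ∷ l)) + countᵇ (not ∘ (a <ᵇ_)) l ∎
  where open ≡-Reasoning
... | false = begin
    countᵇ (x <ᵇ_) (carry (a <ᵇ_) y l) + coinversions (carry (a <ᵇ_) y l)
  ≡⟨ cong₂ _+_ (trans (countᵇ-↭ (x <ᵇ_) (carry-↭ (a <ᵇ_) y l)) (countᵇ-accept (x <ᵇ_) y l (<⇒<ᵇ≡true x<y)))
               (coinversions-carry-large a y l a<ᵇy) ⟩
    suc X + ((countᵇ (y <ᵇ_) l + coinversions l) + countᵇ (not ∘ (a <ᵇ_)) l)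
  ≡⟨ rearrange X (countᵇ (y <ᵇ_) l) _ _ ⟩
    (countᵇ (y <ᵇ_) l + (X + coinversions l)) + suc (countᵇ (not ∘ (a <ᵇ_)) l)
  ≡⟨ cong (λ n → (n + (X + coinversions l)) + _)
       (sym (countᵇ-reject (y <ᵇ_) x l (≤⇒>ᵇ≡false (<⇒≤ x<y)))) ⟩
    (countᵇ (y <ᵇ_) (x ∷ l) + (X + coinversions l)) + suc (countᵇ (not ∘ (a <ᵇ_)) l) ∎
  where
  open ≡-Reasoning
  X = countᵇ (x <ᵇ_) l
  x<y : x < y
  x<y = ≤-<-trans (<ᵇ≡false⇒≥ a x a<ᵇx) (<ᵇ≡true⇒< a y a<ᵇy)
  rearrange : ∀ m n k j → suc m + ((n + k) + j) ≡ (n + (m + k)) + suc j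
  rearrange = solve-∀

coinversions-foata-∷ : ∀ a b l → coinversions (foata (b ∷ l)) ≡ revMaj (b ∷ l) →
                       coinversions (foata (a ∷ b ∷ l)) ≡ revMaj (a ∷ b ∷ l)
coinversions-foata-∷ a b l ih with a <ᵇ b in a<ᵇb
... | false = begin
    countᵇ (a <ᵇ_) (carry p b w) + coinversions (carry p b w)
  ≡⟨ cong (_+ coinversions (carry p b w))
       (trans (countᵇ-↭ (a <ᵇ_) (carry-↭ p b w)) (countᵇ-reject (a <ᵇ_) b w a<ᵇb)) ⟩
    countᵇ (a <ᵇ_) w + coinversions (carry p b w)
  ≡⟨ +-comm (countᵇ (a <ᵇ_) w) _ ⟩
    coinversions (carry p b w) + countᵇ (a <ᵇ_) w
  ≡⟨ coinversions-carry-small a b w a<ᵇb ⟩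
    coinversions (foata (b ∷ l))
  ≡⟨ ih ⟩
    revMaj (b ∷ l) ∎
  where
  open ≡-Reasoning
  p = side a false
  w = foataStep b (foata l)
... | true = begin
    countᵇ (a <ᵇ_) (carry (a <ᵇ_) b w) + coinversions (carry (a <ᵇ_) b w)
  ≡⟨ cong₂ _+_ (trans (countᵇ-↭ (a <ᵇ_) (carry-↭ (a <ᵇ_) b w)) (countᵇ-accept (a <ᵇ_) b w a<ᵇb))
               (coinversions-carry-large a b w a<ᵇb) ⟩
    suc (countᵇ (a <ᵇ_) w) + (coinversions (b ∷ w) + countᵇ (not ∘ (a <ᵇ_)) w)
  ≡⟨ rearrange (countᵇ (a <ᵇ_) w) (coinversions (b ∷ w)) (countᵇ (not ∘ (a <ᵇ_)) w) ⟩
    suc (countᵇ (not ∘ (a <ᵇ_)) w + countᵇ (a <ᵇ_) w) + coinversions (b ∷ w)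
  ≡⟨ cong₂ (λ n m → suc n + m) (trans (countᵇ-not-+ (a <ᵇ_) w) length-w) ih ⟩
    suc (length l) + revMaj (b ∷ l) ∎
  where
  open ≡-Reasoning
  w = foataStep b (foata l)
  length-w : length w ≡ length l
  length-w = ↭-length (↭-trans (foataStep-↭ b (foata l)) (foata-↭ l))
  rearrange : ∀ m n k → suc m + (n + k) ≡ suc (k + m) + n
  rearrange = solve-∀

coinversions-foata : ∀ l → coinversions (foata l) ≡ revMaj l
coinversions-foata []          = refl
coinversions-foata (a ∷ [])    = refl
coinversions-foata (a ∷ b ∷ l) = coinversions-foata-∷ a b l (coinversions-foata (b ∷ l))

uncarry : (ℕ → Bool) → List ℕ → List ℕ → List ℕ
uncarry p acc []      = acc
uncarry p acc (x ∷ t) = if p x then x ∷ (acc ++ uncarry p [] t) else uncarry p (acc ∷ʳ x) t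

lastOr : ℕ → List ℕ → ℕ
lastOr d []      = d
lastOr d (x ∷ l) = lastOr x l

unfoataStep : ℕ → List ℕ → List ℕ
unfoataStep a t = uncarry (side a (a <ᵇ lastOr 0 t)) [] t

-- The first argument is fuel; the inverse of foata on words of length n is unfoata n.
unfoata : ℕ → List ℕ → List ℕ
unfoata zero    t       = t
unfoata (suc n) []      = []
unfoata (suc n) (a ∷ t) = a ∷ unfoata n (unfoataStep a t)

uncarry-carry : ∀ p acc y (l : List ℕ) → p y ≡ true → uncarry p acc (carry p y l) ≡ y ∷ (acc ++ l)
uncarry-carry p acc y []      py rewrite py = refl
uncarry-carry p acc y (x ∷ l) py with p x in px
... | true  rewrite py = cong (λ t → y ∷ (acc ++ t)) (uncarry-carry p [] x l px)
... | false rewrite px = trans (uncarry-carry p (acc ∷ʳ x) y l py) (cong (y ∷_) (++-assoc acc (x ∷ []) l))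

lastOr-carry : ∀ (p : ℕ → Bool) y l d → p y ≡ true → p (lastOr d (carry p y l)) ≡ true
lastOr-carry p y []      d py = py
lastOr-carry p y (x ∷ l) d py with p x in px
... | true  = lastOr-carry p x l y px
... | false = lastOr-carry p y l x py

Rejected : (ℕ → Bool) → List ℕ → Set
Rejected p = All (λ x → p x ≡ false)

carry-++ : ∀ p x acc (w : List ℕ) → Rejected p acc → carry p x (acc ++ w) ≡ acc ++ carry p x w
carry-++ p x []        w []          = refl
carry-++ p x (z ∷ acc) w (pz ∷ pacc) rewrite pz = cong (z ∷_) (carry-++ p x acc w pacc)

carry-uncarry : ∀ (p : ℕ → Bool) acc z (t : List ℕ) x → p x ≡ true → Rejected p acc → p (lastOr z t) ≡ true →
                carry p x (uncarry p acc (z ∷ t)) ≡ x ∷ (acc ++ z ∷ t)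
carry-uncarry p acc z [] x px pacc plast with p z in pz
... | true  rewrite pz = cong (x ∷_) (carry-++ p z acc [] pacc)
carry-uncarry p acc z [] x px pacc () | false
carry-uncarry p acc z (z′ ∷ t) x px pacc plast with p z in pz
... | true  rewrite pz = cong (x ∷_) (trans (carry-++ p z acc (uncarry p [] (z′ ∷ t)) pacc)
                                            (cong (acc ++_) (carry-uncarry p [] z′ t z pz [] plast)))
... | false = trans (carry-uncarry p (acc ∷ʳ z) z′ t x px (All.++⁺ pacc (pz ∷ [])) plast)
                    (cong (x ∷_) (++-assoc acc (z ∷ []) (z′ ∷ t)))

rotate-uncarry : ∀ (p : ℕ → Bool) acc z (t : List ℕ) → Rejected p acc → p (lastOr z t) ≡ true →
                 rotate p (uncarry p acc (z ∷ t)) ≡ acc ++ z ∷ t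
rotate-uncarry p acc z [] pacc plast with p z in pz
... | true  = carry-++ p z acc [] pacc
rotate-uncarry p acc z [] pacc () | false
rotate-uncarry p acc z (z′ ∷ t) pacc plast with p z in pz
... | true  = trans (carry-++ p z acc (uncarry p [] (z′ ∷ t)) pacc)
                    (cong (acc ++_) (carry-uncarry p [] z′ t z pz [] plast))
... | false = trans (rotate-uncarry p (acc ∷ʳ z) z′ t (All.++⁺ pacc (pz ∷ [])) plast)
                    (++-assoc acc (z ∷ []) (z′ ∷ t))

headOr0-uncarry : ∀ (p : ℕ → Bool) acc z (t : List ℕ) → p (lastOr z t) ≡ true →
                  p (headOr0 (uncarry p acc (z ∷ t))) ≡ true
headOr0-uncarry p acc z [] plast with p z in pz
... | true  = pz
headOr0-uncarry p acc z [] () | false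
headOr0-uncarry p acc z (z′ ∷ t) plast with p z in pz
... | true  = pz
... | false = headOr0-uncarry p (acc ∷ʳ z) z′ t plast

unfoataStep-foataStep : ∀ a u → unfoataStep a (foataStep a u) ≡ u
unfoataStep-foataStep a []      = refl
unfoataStep-foataStep a (y ∷ l) =
  trans (cong (λ d → uncarry (side a d) [] (carry p y l))
              (side-true⇒ a (a <ᵇ y) _ (lastOr-carry p y l 0 (side-self a y))))
        (uncarry-carry p [] y l (side-self a y))
  where p = side a (a <ᵇ y)

foataStep-unfoataStep : ∀ a t → foataStep a (unfoataStep a t) ≡ t
foataStep-unfoataStep a []      = refl
foataStep-unfoataStep a (z ∷ t) =
  trans (cong (λ d → rotate (side a d) (uncarry p [] (z ∷ t)))
              (side-true⇒ a (a <ᵇ lastOr z t) _ (headOr0-uncarry p [] z t (side-self a (lastOr z t)))))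
        (rotate-uncarry p [] z t [] (side-self a (lastOr z t)))
  where p = side a (a <ᵇ lastOr z t)

unfoataStep-↭ : ∀ a t → unfoataStep a t ↭ t
unfoataStep-↭ a t = ↭-trans (↭-sym (foataStep-↭ a (unfoataStep a t)))
                            (↭-reflexive (foataStep-unfoataStep a t))

unfoata-foata : ∀ l → unfoata (length l) (foata l) ≡ l
unfoata-foata []      = refl
unfoata-foata (a ∷ l) =
  cong (a ∷_) (trans (cong (unfoata (length l)) (unfoataStep-foataStep a (foata l))) (unfoata-foata l))

foata-unfoata : ∀ n t → length t ≡ n → foata (unfoata n t) ≡ t
foata-unfoata zero    []      _   = refl
foata-unfoata (suc n) (a ∷ t) len = cong (a ∷_) (trans
  (cong (foataStep a) (foata-unfoata n (unfoataStep a t)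
      (trans (↭-length (unfoataStep-↭ a t)) (suc-injective len))))
  (foataStep-unfoataStep a t))

-- The complement x ↦ M + 1 ∸ x on {1, …, M}

complement : ℕ → ℕ → ℕ
complement M x = suc M ∸ x

Bounded : ℕ → ℕ → Set
Bounded M x = 1 ≤ x × x ≤ M

module _ {M : ℕ} where

  complement-+ : ∀ {x} → Bounded M x → x + complement M x ≡ suc M
  complement-+ (_ , x≤M) = m+[n∸m]≡n (m≤n⇒m≤1+n x≤M)

  complement-bounded : ∀ {x} → Bounded M x → Bounded M (complement M x)
  complement-bounded {x} (1≤x , x≤M) =
    subst (1 ≤_) (sym (+-∸-assoc 1 x≤M)) (s≤s z≤n) , ∸-monoʳ-≤ (suc M) 1≤x

  complement-involutive : ∀ {x} → Bounded M x → complement M (complement M x) ≡ x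
  complement-involutive (_ , x≤M) = m∸[m∸n]≡n (m≤n⇒m≤1+n x≤M)

  complement-<ᵇ : ∀ {x y} → Bounded M x → Bounded M y → (complement M y <ᵇ complement M x) ≡ (x <ᵇ y)
  complement-<ᵇ {x} {y} bx by with x <ᵇ y in x<ᵇy
  ... | true  = <⇒<ᵇ≡true (flip-< sums-equal (<ᵇ≡true⇒< x y x<ᵇy))
    where
    sums-equal : x + complement M x ≡ y + complement M y
    sums-equal = trans (complement-+ bx) (sym (complement-+ by))
    flip-< : ∀ {a b c d} → a + b ≡ c + d → a < c → d < b
    flip-< {a} e a<c = ≰⇒> (λ b≤d → <⇒≢ (+-mono-<-≤ a<c b≤d) e)
  ... | false = ≤⇒>ᵇ≡false (flip-≤ sums-equal (<ᵇ≡false⇒≥ x y x<ᵇy))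
    where
    sums-equal : y + complement M y ≡ x + complement M x
    sums-equal = trans (complement-+ by) (sym (complement-+ bx))
    flip-≤ : ∀ {a b c d} → a + b ≡ c + d → a ≤ c → d ≤ b
    flip-≤ e a≤c = ≮⇒≥ (λ b<d → <⇒≢ (+-mono-≤-< a≤c b<d) e)

  map-complement-involutive : ∀ {l} → All (Bounded M) l → map (complement M) (map (complement M) l) ≡ l
  map-complement-involutive []       = refl
  map-complement-involutive (b ∷ bs) = cong₂ _∷_ (complement-involutive b) (map-complement-involutive bs)

  inversions-complement : ∀ {l} → All (Bounded M) l → inversions (map (complement M) l) ≡ coinversions l
  inversions-complement []                = refl
  inversions-complement {x ∷ l} (bx ∷ bl) = cong₂ _+_
    (trans (countᵇ-map (_<ᵇ complement M x) (complement M) l)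
           (countᵇ-cong _ _ bl (λ by → complement-<ᵇ bx by)))
    (inversions-complement bl)

  coinversions-complement : ∀ {l} → All (Bounded M) l → coinversions (map (complement M) l) ≡ inversions l
  coinversions-complement []                = refl
  coinversions-complement {x ∷ l} (bx ∷ bl) = cong₂ _+_
    (trans (countᵇ-map (complement M x <ᵇ_) (complement M) l)
           (countᵇ-cong _ _ bl (λ by → complement-<ᵇ by bx)))
    (coinversions-complement bl)

  complement-≡ᵇ : ∀ {x j} → Bounded M x → Bounded M j → (j ≡ᵇ complement M x) ≡ (complement M j ≡ᵇ x)
  complement-≡ᵇ {x} {j} bx bj = ≡ᵇ-cong {j} {complement M x} {complement M j} {x}
    (λ { refl → complement-involutive bx }) (λ { refl → sym (complement-involutive bj) })

  complement-≡ᵇ-beyond : ∀ {x j} → Bounded M x → M < j → (j ≡ᵇ complement M x) ≡ false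
  complement-≡ᵇ-beyond {x} {j} bx M<j =
    ≢⇒≡ᵇ≡false {j} {complement M x} (λ { refl → <⇒≱ M<j (proj₂ (complement-bounded bx)) })

-- Fillings of a hook

hookFilling : ℕ → List ℕ → List ℕ → Filling
hookFilling b bs cs = (b ∷ bs) ∷ map [_] cs

shape-hookFilling : ∀ b bs cs → map length (hookFilling b bs cs) ≡ hook (length bs) (length cs)
shape-hookFilling b bs cs = cong (suc (length bs) ∷_) (lengths cs)
  where
  lengths : ∀ cs → map length (map [_] cs) ≡ replicate (length cs) 1
  lengths []       = refl
  lengths (c ∷ cs) = cong (1 ∷_) (lengths cs)

data HookView (a k : ℕ) : Filling → Set where
  hookView : ∀ b bs cs → length bs ≡ a → length cs ≡ k → HookView a k (hookFilling b bs cs)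

hookView-of : ∀ {a k σ} → map length σ ≡ hook a k → HookView a k σ
hookView-of {a} {k} {(b ∷ bs) ∷ rest} eq with singletons k rest (∷-injectiveʳ eq)
  where
  singletons : ∀ k (rs : Filling) → map length rs ≡ replicate k 1 →
               ∃ λ cs → rs ≡ map [_] cs × length cs ≡ k
  singletons zero    []              _  = [] , refl , refl
  singletons (suc k) ((c ∷ []) ∷ rs) eq with singletons k rs (∷-injectiveʳ eq)
  ... | cs , refl , refl = c ∷ cs , refl , refl
... | cs , refl , refl = hookView b bs cs (suc-injective (∷-injectiveˡ eq)) refl

conj-hook : ∀ a k → conj (hook a k) ≡ hook k a
conj-hook a k = cong₂ _∷_ (cong suc (rowsOfLength≥1 k))
  (trans (map-applyUpTo suc _ a) (applyUpTo-replicate _ 1 a armRow))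
  where
  rowsOfLength≥1 : ∀ k → length (filter (1 ≤?_) (replicate k 1)) ≡ k
  rowsOfLength≥1 zero    = refl
  rowsOfLength≥1 (suc k) = cong suc (rowsOfLength≥1 k)
  rowsOfLength≥2 : ∀ i k → length (filter (suc (suc i) ≤?_) (replicate k 1)) ≡ 0
  rowsOfLength≥2 i zero    = refl
  rowsOfLength≥2 i (suc k) = rowsOfLength≥2 i k
  armRow : ∀ i → i < a → length (filter (suc (suc i) ≤?_) (hook a k)) ≡ 1
  armRow i i<a rewrite <⇒<ᵇ≡true i<a = cong suc (rowsOfLength≥2 i k)

length-filter-≟ : ∀ i row → length (filter (i ≟_) row) ≡ countᵇ (i ≡ᵇ_) row
length-filter-≟ i []        = refl
length-filter-≟ i (x ∷ row) with i ≡ᵇ x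
... | true  = cong suc (length-filter-≟ i row)
... | false = length-filter-≟ i row

count-concat : ∀ i σ → count i σ ≡ countᵇ (i ≡ᵇ_) (concat σ)
count-concat i []        = refl
count-concat i (row ∷ σ) = trans (cong₂ _+_ (length-filter-≟ i row) (count-concat i σ))
                                 (sym (countᵇ-++ (i ≡ᵇ_) row (concat σ)))

concat-hookFilling : ∀ b bs cs → concat (hookFilling b bs cs) ≡ (b ∷ bs) ++ cs
concat-hookFilling b bs cs = cong ((b ∷ bs) ++_) (concat-map-[ cs ])

maj-hookFilling : ∀ b bs cs → maj (hookFilling b bs cs) ≡ revMaj (b ∷ cs)
maj-hookFilling b bs cs = begin
    majWord (columnTopDown σ 0) + sum (map (majWord ∘ columnTopDown σ) (applyUpTo suc (length bs)))
  ≡⟨ cong₂ _+_ (cong (λ l → majWord (reverse (b ∷ l))) (firstEntries cs))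
       (trans (cong sum (map-applyUpTo suc _ (length bs)))
              (sum-applyUpTo-≡0 _ (length bs) upperColumns)) ⟩
    majWord (reverse (b ∷ cs)) + 0
  ≡⟨ trans (+-identityʳ _) (majWord-reverse (b ∷ cs)) ⟩
    revMaj (b ∷ cs) ∎
  where
  open ≡-Reasoning
  σ = hookFilling b bs cs
  firstEntries : ∀ cs → mapMaybe (λ row → nth row 0) (map [_] cs) ≡ cs
  firstEntries []       = refl
  firstEntries (c ∷ cs) = cong (c ∷_) (firstEntries cs)
  laterEntries : ∀ j cs → mapMaybe (λ row → nth row (suc j)) (map [_] cs) ≡ []
  laterEntries j []       = refl
  laterEntries j (c ∷ cs) = laterEntries j cs
  upperColumns : ∀ j → majWord (columnTopDown σ (suc j)) ≡ 0
  upperColumns j with nth bs j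
  ... | just _  rewrite laterEntries j cs = refl
  ... | nothing rewrite laterEntries j cs = refl

data BottomCell : Cell → Set where
  bottom : ∀ c v → BottomCell (0 , c , v)

data UpperCell : Cell → Set where
  upper : ∀ r v → UpperCell (suc r , 0 , v)

data RightOf (b : ℕ) : Cell → Set where
  rightOf : ∀ c v → b < c → RightOf b (0 , c , v)

value : Cell → ℕ
value (_ , _ , v) = v

attacks : Cell → Cell → ℕ
attacks u v = if attackingInv u v then 1 else 0

attackingPairs : List Cell → ℕ
attackingPairs L = sum (map (λ u → sum (map (attacks u) L)) L)

attacks-upper-bottom : ∀ {u v} → UpperCell u → BottomCell v → attacks u v ≡ 0
attacks-upper-bottom (upper r x) (bottom c y) rewrite ∧-zeroʳ (r ≡ᵇ 0) | ∧-zeroʳ (y <ᵇ x) = refl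

attacks-upper-upper : ∀ {u v} → UpperCell u → UpperCell v → attacks u v ≡ 0
attacks-upper-upper (upper r x) (upper r′ y)
  rewrite ∧-zeroʳ (r ≡ᵇ r′) | ∧-zeroʳ (r ≡ᵇ suc r′) | ∧-zeroʳ (y <ᵇ x) = refl

attacks-bottom-upper : ∀ {u v} → BottomCell u → UpperCell v → attacks u v ≡ 0
attacks-bottom-upper (bottom c x) (upper r y) rewrite ∧-zeroʳ (y <ᵇ x) = refl

attacks-rightOf : ∀ {b v} x → RightOf b v → attacks (0 , b , x) v ≡ (if value v <ᵇ x then 1 else 0)
attacks-rightOf x (rightOf c y b<c) rewrite <⇒<ᵇ≡true b<c | ∧-identityʳ (y <ᵇ x) = refl

attacks-leftOf : ∀ {b u} x → RightOf b u → attacks u (0 , b , x) ≡ 0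
attacks-leftOf x (rightOf c y b<c) rewrite ≤⇒>ᵇ≡false (<⇒≤ b<c) | ∧-zeroʳ (x <ᵇ y) = refl

attacks-irreflexive : ∀ c x → attacks (0 , c , x) (0 , c , x) ≡ 0
attacks-irreflexive c x rewrite ≤⇒>ᵇ≡false (≤-refl {x}) = refl

bottomCells : (ℕ → ℕ) → List ℕ → List Cell
bottomCells f xs = zipWith (λ c v → (0 , c , v)) (applyUpTo f (length xs)) xs

bottomCells-bottom : ∀ f xs → All BottomCell (bottomCells f xs)
bottomCells-bottom f []       = []
bottomCells-bottom f (x ∷ xs) = bottom (f 0) x ∷ bottomCells-bottom (f ∘ suc) xs

bottomCells-rightOf : ∀ b f xs → (∀ i → b < f i) → All (RightOf b) (bottomCells f xs)
bottomCells-rightOf b f []       _   = []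
bottomCells-rightOf b f (x ∷ xs) b<f = rightOf (f 0) x (b<f 0) ∷ bottomCells-rightOf b (f ∘ suc) xs (b<f ∘ suc)

map-value-bottomCells : ∀ f xs → map value (bottomCells f xs) ≡ xs
map-value-bottomCells f []       = refl
map-value-bottomCells f (x ∷ xs) = cong (x ∷_) (map-value-bottomCells (f ∘ suc) xs)

sum-attacks-rightOf : ∀ b x {L} → All (RightOf b) L →
                      sum (map (attacks (0 , b , x)) L) ≡ countᵇ (_<ᵇ x) (map value L)
sum-attacks-rightOf b x []                 = refl
sum-attacks-rightOf b x {v ∷ L} (r ∷ rs) rewrite attacks-rightOf x r with value v <ᵇ x
... | true  = cong suc (sum-attacks-rightOf b x rs)
... | false = sum-attacks-rightOf b x rs

attackingPairs-bottomCells : ∀ f xs → f Preserves _<_ ⟶ _<_ → attackingPairs (bottomCells f xs) ≡ inversions xs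
attackingPairs-bottomCells f []       _      = refl
attackingPairs-bottomCells f (x ∷ xs) f-mono = begin
    (attacks c₀ c₀ + sum (map (attacks c₀) L)) + sum (map (λ u → attacks u c₀ + sum (map (attacks u) L)) L)
  ≡⟨ cong₂ _+_ (cong (_+ sum (map (attacks c₀) L)) (attacks-irreflexive (f 0) x))
               (sum-map-+ (λ u → attacks u c₀) (λ u → sum (map (attacks u) L)) L) ⟩
    sum (map (attacks c₀) L) + (sum (map (λ u → attacks u c₀) L) + attackingPairs L)
  ≡⟨ cong₂ _+_ (trans (sum-attacks-rightOf (f 0) x right)
               (cong (countᵇ (_<ᵇ x)) (map-value-bottomCells (f ∘ suc) xs)))
               (cong (_+ attackingPairs L) (sum-map-≡0 (λ u → attacks u c₀) right (attacks-leftOf x))) ⟩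
    countᵇ (_<ᵇ x) xs + attackingPairs L
  ≡⟨ cong (_+_ (countᵇ (_<ᵇ x) xs)) (attackingPairs-bottomCells (f ∘ suc) xs (λ i<j → f-mono (s<s i<j))) ⟩
    countᵇ (_<ᵇ x) xs + inversions xs ∎
  where
  open ≡-Reasoning
  c₀ : Cell
  c₀ = (0 , f 0 , x)
  L = bottomCells (f ∘ suc) xs
  right : All (RightOf (f 0)) L
  right = bottomCells-rightOf (f 0) (f ∘ suc) xs (λ i → f-mono z<s)

attackingPairs-++-upper : ∀ {A B} → All BottomCell A → All UpperCell B →
  attackingPairs (A ++ B) ≡ attackingPairs A
attackingPairs-++-upper {A} {B} bA uB = begin
    sum (map F (A ++ B))
  ≡⟨ sum-map-++ F A B ⟩
    sum (map F A) + sum (map F B)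
  ≡⟨ cong₂ _+_ (sum-map-cong F (λ u → sum (map (attacks u) A)) bA fromBottom) (sum-map-≡0 F uB fromUpper) ⟩
    attackingPairs A + 0
  ≡⟨ +-identityʳ _ ⟩
    attackingPairs A ∎
  where
  open ≡-Reasoning
  F : Cell → ℕ
  F u = sum (map (attacks u) (A ++ B))
  fromBottom : ∀ {u} → BottomCell u → F u ≡ sum (map (attacks u) A)
  fromBottom {u} bu = trans (sum-map-++ (attacks u) A B)
    (trans (cong (_+_ (sum (map (attacks u) A))) (sum-map-≡0 (attacks u) uB (attacks-bottom-upper bu)))
           (+-identityʳ _))
  fromUpper : ∀ {u} → UpperCell u → F u ≡ 0
  fromUpper {u} uu = trans (sum-map-++ (attacks u) A B)
    (cong₂ _+_ (sum-map-≡0 (attacks u) bA (attacks-upper-bottom uu))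
               (sum-map-≡0 (attacks u) uB (attacks-upper-upper uu)))

upperCells-upper : ∀ (g : ℕ → ℕ) n cs →
  All UpperCell (concat (zipWith cellsRow (applyUpTo (suc ∘ g) n) (map [_] cs)))
upperCells-upper g zero    cs       = []
upperCells-upper g (suc n) []       = []
upperCells-upper g (suc n) (c ∷ cs) = upper (g 0) c ∷ upperCells-upper (g ∘ suc) n cs

attackingCount-hookFilling : ∀ b bs cs → attackingCount (hookFilling b bs cs) ≡ inversions (b ∷ bs)
attackingCount-hookFilling b bs cs = begin
    attackingCount (hookFilling b bs cs)
  ≡⟨ sum-map-cartesianProduct (λ p → attacks (proj₁ p) (proj₂ p)) (cells σ) (cells σ) ⟩
    attackingPairs (bottomCells (λ i → i) (b ∷ bs) ++ upperCells)
  ≡⟨ attackingPairs-++-upper (bottomCells-bottom (λ i → i) (b ∷ bs))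
                             (upperCells-upper (λ i → i) (length (map [_] cs)) cs) ⟩
    attackingPairs (bottomCells (λ i → i) (b ∷ bs))
  ≡⟨ attackingPairs-bottomCells (λ i → i) (b ∷ bs) (λ i<j → i<j) ⟩
    inversions (b ∷ bs) ∎
  where
  open ≡-Reasoning
  σ = hookFilling b bs cs
  upperCells = concat (zipWith cellsRow (applyUpTo suc (length (map [_] cs))) (map [_] cs))

rowLength≡ : ∀ σ r → rowLength σ r ≡ maybe′ length 0 (nth σ r)
rowLength≡ σ r with nth σ r
... | just _  = refl
... | nothing = refl

descentArms-hookFilling : ∀ b bs cs → descentArms (hookFilling b bs cs) ≡ 0
descentArms-hookFilling b bs cs =
  trans (sum-map-++ F (bottomCells (λ i → i) (b ∷ bs)) upperCells)
        (cong₂ _+_ (sum-map-≡0 F (bottomCells-bottom (λ i → i) (b ∷ bs)) λ { (bottom _ _) → refl })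
                   (sum-map-≡0 F (upperCells-upper (λ i → i) (length (map [_] cs)) cs) noArm))
  where
  σ = hookFilling b bs cs
  upperCells = concat (zipWith cellsRow (applyUpTo suc (length (map [_] cs))) (map [_] cs))
  F : Cell → ℕ
  F x = if isDescent σ x then armLength σ x else 0
  singletonRows : ∀ cs r → maybe′ length 0 (nth (map [_] cs) r) ∸ 1 ≡ 0
  singletonRows []       r       = refl
  singletonRows (c ∷ cs) zero    = refl
  singletonRows (c ∷ cs) (suc r) = singletonRows cs r
  noArm : ∀ {x} → UpperCell x → F x ≡ 0
  noArm (upper r v) with isDescent σ (suc r , 0 , v)
  ... | true  = trans (cong (_∸ 1) (rowLength≡ σ (suc r))) (singletonRows cs r)
  ... | false = refl

inv-hookFilling : ∀ b bs cs → inv (hookFilling b bs cs) ≡ + inversions (b ∷ bs)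
inv-hookFilling b bs cs rewrite attackingCount-hookFilling b bs cs | descentArms-hookFilling b bs cs =
  cong +_ (+-identityʳ _)

bounded-by-counts : ∀ M W → All (1 ≤_) W → (∀ j → M ≤ j → countᵇ (suc j ≡ᵇ_) W ≡ 0) → All (Bounded M) W
bounded-by-counts M []          []         _      = []
bounded-by-counts M (suc j ∷ W) (1≤x ∷ ps) absent =
  (1≤x , x≤M) ∷ bounded-by-counts M W ps (λ i M≤i → countᵇ-∷-≡0 _ (suc j) W (absent i M≤i))
  where
  x≤M : suc j ≤ M
  x≤M with suc j ≤? M
  ... | yes x≤M = x≤M
  ... | no  x≰M = contradiction
    (trans (sym (countᵇ-accept (suc j ≡ᵇ_) (suc j) W (Equivalence.to T-≡ (≡⇒≡ᵇ j j refl))))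
           (absent j (≤-pred (≰⇒> x≰M))))
    1+n≢0

entries-bounded : ∀ {μ} α {σ} → IsFilling μ α σ → All (Bounded (length α)) (concat σ)
entries-bounded α {σ} (_ , positive , content) =
  bounded-by-counts (length α) (concat σ) (All.concat⁺ positive) λ j M≤j → begin
    countᵇ (suc j ≡ᵇ_) (concat σ)  ≡⟨ count-concat (suc j) σ ⟨
    count (suc j) σ               ≡⟨ content j ⟩
    nthOr0 α j                    ≡⟨ nthOr0≡ α j ⟩
    fromMaybe 0 (nth α j)  ≡⟨ cong (fromMaybe 0) (nth-beyond α j M≤j) ⟩
    0                             ∎
  where open ≡-Reasoning

content-complement : ∀ α σ τ → All (Bounded (length α)) (concat σ) →
  (∀ i → count (suc i) σ ≡ nthOr0 α i) → concat τ ↭ map (complement (length α)) (concat σ) →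
  ∀ i → count (suc i) τ ≡ nthOr0 (reverse α) i
content-complement α σ τ bounded content τ↭ i = begin
    count (suc i) τ
  ≡⟨ count-concat (suc i) τ ⟩
    countᵇ (suc i ≡ᵇ_) (concat τ)
  ≡⟨ countᵇ-↭ (suc i ≡ᵇ_) τ↭ ⟩
    countᵇ (suc i ≡ᵇ_) (map (complement M) (concat σ))
  ≡⟨ countᵇ-map (suc i ≡ᵇ_) (complement M) (concat σ) ⟩
    countᵇ ((suc i ≡ᵇ_) ∘ complement M) (concat σ)
  ≡⟨ reflected ⟩
    nthOr0 (reverse α) i ∎
  where
  open ≡-Reasoning
  M = length α
  reflected : countᵇ ((suc i ≡ᵇ_) ∘ complement M) (concat σ) ≡ nthOr0 (reverse α) i
  reflected with suc i ≤? M
  ... | yes i<M = begin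
      countᵇ ((suc i ≡ᵇ_) ∘ complement M) (concat σ)
    ≡⟨ countᵇ-cong _ _ bounded (λ bx → complement-≡ᵇ bx (s≤s z≤n , i<M)) ⟩
      countᵇ (complement M (suc i) ≡ᵇ_) (concat σ)
    ≡⟨ cong (λ j → countᵇ (j ≡ᵇ_) (concat σ)) (+-∸-assoc 1 i<M) ⟩
      countᵇ (suc (M ∸ suc i) ≡ᵇ_) (concat σ)
    ≡⟨ count-concat (suc (M ∸ suc i)) σ ⟨
      count (suc (M ∸ suc i)) σ
    ≡⟨ content (M ∸ suc i) ⟩
      nthOr0 α (M ∸ suc i)
    ≡⟨ trans (nthOr0≡ α _) (cong (fromMaybe 0) (sym (nth-reverse α i i<M))) ⟩
      fromMaybe 0 (nth (reverse α) i)
    ≡⟨ nthOr0≡ (reverse α) i ⟨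
      nthOr0 (reverse α) i ∎
  ... | no i≮M = begin
      countᵇ ((suc i ≡ᵇ_) ∘ complement M) (concat σ)
    ≡⟨ countᵇ-cong _ _ bounded (λ bx → complement-≡ᵇ-beyond bx (≰⇒> i≮M)) ⟩
      countᵇ (λ _ → false) (concat σ)
    ≡⟨ countᵇ-false (concat σ) ⟩
      0
    ≡⟨ cong (fromMaybe 0) (nth-beyond (reverse α) i
          (subst (_≤ i) (sym (length-reverse α)) (≤-pred (≰⇒> i≮M)))) ⟨
      fromMaybe 0 (nth (reverse α) i)
    ≡⟨ nthOr0≡ (reverse α) i ⟨
      nthOr0 (reverse α) i ∎

φ : ℕ → Filling → Filling
φ M []                = []
φ M ([] ∷ _)          = []
φ M ((b ∷ bs) ∷ rest) =
  map (complement M) (foata (b ∷ map headOr0 rest))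
    ∷ map [_] (drop 1 (unfoata (suc (length bs)) (map (complement M) (b ∷ bs))))

φ-hookFilling : ∀ M b bs cs → φ M (hookFilling b bs cs) ≡
  hookFilling (complement M b) (map (complement M) (foataStep b (foata cs)))
              (unfoata (length bs) (unfoataStep (complement M b) (map (complement M) bs)))
φ-hookFilling M b bs cs = cong (λ l → map (complement M) (foata (b ∷ l)) ∷ _) (firstEntries cs)
  where
  firstEntries : ∀ cs → map headOr0 (map [_] cs) ≡ cs
  firstEntries []       = refl
  firstEntries (c ∷ cs) = cong (c ∷_) (firstEntries cs)

module HookImage (M b : ℕ) (bs cs : List ℕ) (σ-bounded : All (Bounded M) (concat (hookFilling b bs cs))) where

  bounded : All (Bounded M) ((b ∷ bs) ++ cs)
  bounded = subst (All (Bounded M)) (concat-hookFilling b bs cs) σ-bounded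

  b′ : ℕ
  b′ = complement M b

  row′ col′ : List ℕ
  row′ = map (complement M) (foataStep b (foata cs))
  col′ = unfoata (length bs) (unfoataStep b′ (map (complement M) bs))

  image : Filling
  image = hookFilling b′ row′ col′

  φ-hookFilling-image : φ M (hookFilling b bs cs) ≡ image
  φ-hookFilling-image = φ-hookFilling M b bs cs

  row-bounded : All (Bounded M) (b ∷ bs)
  row-bounded = All.++⁻ˡ (b ∷ bs) bounded

  column-bounded : All (Bounded M) (b ∷ cs)
  column-bounded = head row-bounded ∷ All.++⁻ʳ (b ∷ bs) bounded

  foata-column-bounded : All (Bounded M) (foata (b ∷ cs))
  foata-column-bounded = All-resp-↭ (↭-sym (foata-↭ (b ∷ cs))) column-bounded

  foata-col′ : foata (b′ ∷ col′) ≡ map (complement M) (b ∷ bs)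
  foata-col′ =
    foata-unfoata (suc (length bs)) (map (complement M) (b ∷ bs)) (length-map (complement M) (b ∷ bs))

  col′-↭ : b′ ∷ col′ ↭ map (complement M) (b ∷ bs)
  col′-↭ = ↭-trans (↭-sym (foata-↭ (b′ ∷ col′))) (↭-reflexive foata-col′)

  row′-↭ : b′ ∷ row′ ↭ map (complement M) (b ∷ cs)
  row′-↭ = ↭-map⁺ (complement M) (foata-↭ (b ∷ cs))

  concat-image-↭ : concat image ↭ map (complement M) (concat (hookFilling b bs cs))
  concat-image-↭ = begin
    (b′ ∷ row′) ++ concat (map [_] col′)  ≡⟨ cong ((b′ ∷ row′) ++_) (concat-map-[ col′ ]) ⟩
    (b′ ∷ row′) ++ col′                   ↭⟨ ↭-++⁺ row′-↭ (drop-∷ col′-↭) ⟩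
    map (complement M) (b ∷ cs) ++ map (complement M) bs  ≡⟨ map-++ (complement M) (b ∷ cs) bs ⟨
    map (complement M) ((b ∷ cs) ++ bs)   ↭⟨ ↭-map⁺ (complement M) (↭-prep b (↭-++-comm cs bs)) ⟩
    map (complement M) ((b ∷ bs) ++ cs)   ≡⟨ cong (map (complement M)) (concat-hookFilling b bs cs) ⟨
    map (complement M) (concat (hookFilling b bs cs)) ∎
    where open PermutationReasoning

  image-bounded : All (Bounded M) (concat image)
  image-bounded = All-resp-↭ (↭-sym concat-image-↭) (All.map⁺ (mapAll complement-bounded σ-bounded))

  length-row′ : length row′ ≡ length cs
  length-row′ = suc-injective (trans (↭-length row′-↭) (length-map (complement M) (b ∷ cs)))

  length-col′ : length col′ ≡ length bs
  length-col′ = suc-injective (trans (↭-length col′-↭) (length-map (complement M) (b ∷ bs)))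

  shape-image : map length image ≡ hook (length cs) (length bs)
  shape-image = trans (shape-hookFilling b′ row′ col′) (cong₂ hook length-row′ length-col′)

  φ-image : φ M image ≡ hookFilling b bs cs
  φ-image = begin
      φ M image
    ≡⟨ φ-hookFilling M b′ row′ col′ ⟩
      hookFilling (complement M b′) (map (complement M) (foataStep b′ (foata col′)))
                  (drop 1 (unfoata (suc (length row′)) (map (complement M) (b′ ∷ row′))))
    ≡⟨ cong₂ (λ x row → hookFilling x row col″) (complement-involutive (head row-bounded)) row-restored ⟩
      hookFilling b bs (drop 1 (unfoata (suc (length row′)) (map (complement M) (b′ ∷ row′))))
    ≡⟨ cong (hookFilling b bs ∘ drop 1) column-restored ⟩
      hookFilling b bs cs ∎
    where
    open ≡-Reasoning
    col″ = drop 1 (unfoata (suc (length row′)) (map (complement M) (b′ ∷ row′)))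
    row-restored : map (complement M) (foataStep b′ (foata col′)) ≡ bs
    row-restored = trans (cong (map (complement M) ∘ drop 1) foata-col′)
                         (map-complement-involutive (All.++⁻ʳ (b ∷ []) row-bounded))
    column-restored : unfoata (suc (length row′)) (map (complement M) (b′ ∷ row′)) ≡ b ∷ cs
    column-restored =
      trans (cong₂ unfoata (cong suc length-row′) (map-complement-involutive foata-column-bounded))
            (unfoata-foata (b ∷ cs))

  maj-image : maj image ≡ inversions (b ∷ bs)
  maj-image = begin
    maj image                                  ≡⟨ maj-hookFilling b′ row′ col′ ⟩
    revMaj (b′ ∷ col′)                         ≡⟨ coinversions-foata (b′ ∷ col′) ⟨
    coinversions (foata (b′ ∷ col′))           ≡⟨ cong coinversions foata-col′ ⟩
    coinversions (map (complement M) (b ∷ bs)) ≡⟨ coinversions-complement row-bounded ⟩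
    inversions (b ∷ bs)                        ∎
    where open ≡-Reasoning

  inv-image : inv image ≡ + maj (hookFilling b bs cs)
  inv-image = begin
    inv image                                            ≡⟨ inv-hookFilling b′ row′ col′ ⟩
    + inversions (map (complement M) (foata (b ∷ cs)))   ≡⟨ cong +_ (inversions-complement foata-column-bounded) ⟩
    + coinversions (foata (b ∷ cs))                      ≡⟨ cong +_ (coinversions-foata (b ∷ cs)) ⟩
    + revMaj (b ∷ cs)                                    ≡⟨ cong +_ (maj-hookFilling b bs cs) ⟨
    + maj (hookFilling b bs cs)                          ∎
    where open ≡-Reasoning

φ-isFilling : ∀ {a k} α {σ} → IsFilling (hook a k) α σ → IsFilling (hook k a) (reverse α) (φ (length α) σ)
φ-isFilling α σ-filling@(shape , _ , content) with hookView-of shape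
... | hookView b bs cs refl refl = subst (IsFilling _ (reverse α)) (sym φ-hookFilling-image)
  (shape-image , All.concat⁻ (mapAll proj₁ image-bounded) ,
   content-complement α (hookFilling b bs cs) image (entries-bounded α σ-filling) content concat-image-↭)
  where open HookImage (length α) b bs cs (entries-bounded α σ-filling)

φ-involutive : ∀ {a k} α {σ} → IsFilling (hook a k) α σ → φ (length α) (φ (length α) σ) ≡ σ
φ-involutive α σ-filling@(shape , _) with hookView-of shape
... | hookView b bs cs refl refl = trans (cong (φ (length α)) φ-hookFilling-image) φ-image
  where open HookImage (length α) b bs cs (entries-bounded α σ-filling)

maj-φ : ∀ {a k} α {σ} → IsFilling (hook a k) α σ → + maj (φ (length α) σ) ≡ inv σ
maj-φ α σ-filling@(shape , _) with hookView-of shape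
... | hookView b bs cs refl refl =
  trans (cong (+_ ∘ maj) φ-hookFilling-image) (trans (cong +_ maj-image) (sym (inv-hookFilling b bs cs)))
  where open HookImage (length α) b bs cs (entries-bounded α σ-filling)

inv-φ : ∀ {a k} α {σ} → IsFilling (hook a k) α σ → inv (φ (length α) σ) ≡ + maj σ
inv-φ α σ-filling@(shape , _) with hookView-of shape
... | hookView b bs cs refl refl = trans (cong inv φ-hookFilling-image) inv-image
  where open HookImage (length α) b bs cs (entries-bounded α σ-filling)

mainTheorem2 : (a k : ℕ) (α : List ℕ) →
    (∃₂ λ β x → (α ≡ β ∷ʳ x) × (0 < x)) →
    sum α ≡ sum (hook a k) →
    Σ (Filling → Filling) λ φ →
      (∀ σ → IsFilling (hook a k) α σ → IsFilling (conj (hook a k)) (reverse α) (φ σ))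
      × (∀ σ τ → IsFilling (hook a k) α σ → IsFilling (hook a k) α τ → φ σ ≡ φ τ → σ ≡ τ)
      × (∀ τ → IsFilling (conj (hook a k)) (reverse α) τ →
           ∃ λ σ → IsFilling (hook a k) α σ × (φ σ ≡ τ))
      × (∀ σ → IsFilling (hook a k) α σ →
           ((+ maj (φ σ)) ≡ inv σ) × (inv (φ σ) ≡ (+ maj σ)))
mainTheorem2 a k α _ _ = φ M , onto-conjugate , injective , surjective , statistics
  where
  M = length α
  onto-conjugate : ∀ σ → IsFilling (hook a k) α σ → IsFilling (conj (hook a k)) (reverse α) (φ M σ)
  onto-conjugate σ σ-filling =
    subst (λ μ → IsFilling μ (reverse α) (φ M σ)) (sym (conj-hook a k)) (φ-isFilling α σ-filling)
  injective : ∀ σ τ → IsFilling (hook a k) α σ → IsFilling (hook a k) α τ → φ M σ ≡ φ M τ → σ ≡ τ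
  injective σ τ σ-filling τ-filling eq =
    trans (sym (φ-involutive α σ-filling)) (trans (cong (φ M) eq) (φ-involutive α τ-filling))
  surjective : ∀ τ → IsFilling (conj (hook a k)) (reverse α) τ → ∃ λ σ → IsFilling (hook a k) α σ × (φ M σ ≡ τ)
  surjective τ τ-filling = φ M τ ,
    subst₂ (λ β N → IsFilling (hook a k) β (φ N τ)) (reverse-involutive α) (length-reverse α)
           (φ-isFilling (reverse α) τ-filling′) ,
    subst (λ N → φ N (φ N τ) ≡ τ) (length-reverse α) (φ-involutive (reverse α) τ-filling′)
    where
    τ-filling′ : IsFilling (hook k a) (reverse α) τ
    τ-filling′ = subst (λ μ → IsFilling μ (reverse α) τ) (conj-hook a k) τ-filling
  statistics : ∀ σ → IsFilling (hook a k) α σ → (+ maj (φ M σ) ≡ inv σ) × (inv (φ M σ) ≡ + maj σ)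
  statistics _ σ-filling = maj-φ α σ-filling , inv-φ α σ-filling
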